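{- If $G$ is one of the following graphs, then $mvd(G)=1$: (i) a wheel graph $W_n=C_{n-1}\vee K_1$ other than $W_4$ (i.e. $n\geq 5$); (ii) a complete $k$-partite graph $G=K_{n_1,\ldots,n_k}$ with $k>2$ and $n_k\geq 2$, $n_{k-1}\geq 2$.
   Context: $G\vee H$ denotes the join of vertex-disjoint graphs $G,H$ (add all edges between $V(G)$ and $V(H)$); $C_{n-1}$ is the cycle on $n-1$ vertices. $K_{n_1,\ldots,n_k}$ is the complete $k$-partite graph with parts of sizes $n_1,\ldots,n_k$. For a vertex-colored graph and two nonadjacent vertices $x,y$, an $x$-$y$ vertex cut is a set $S\subseteq V(G)\setminus\{x,y\}$ such that $x$ and $y$ lie in different components of $G-S$; it is monochromatic if all its vertices have the same color. A vertex-coloring is an MVD-coloring if every pair of nonadjacent vertices has a monochromatic vertex cut separating them. $mvd(G)$ is the maximum number of colors used by an MVD-coloring of $G$. -}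

module Defs where

open import Data.Nat using (ℕ; zero; suc; _≤_; _<_)
open import Data.Fin using (Fin; toℕ; fromℕ; inject₁)
open import Data.Product using (Σ; ∃; _×_; _,_)
open import Data.Sum using (_⊎_)
open import Relation.Binary.PropositionalEquality using (_≡_; _≢_)
open import Relation.Nullary using (¬_)
open import Data.Empty using (⊥)
open import Data.Unit using (⊤)

record Graph : Set₁ where
  field
    V   : Set
    Adj : V → V → Set
open Graph public

VSet : Graph → Set₁
VSet G = V G → Set

-- x reaches y in G - S  (x itself is assumed outside S by the caller).
data Reach (G : Graph) (S : VSet G) (x : V G) : V G → Set where
  here : Reach G S x x
  step : ∀ {y z} → Reach G S x y → Adj G y z → ¬ S z → Reach G S x z

IsCut : (G : Graph) → VSet G → V G → V G → Set
IsCut G S x y = ¬ S x × ¬ S y × ¬ Reach G S x y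

Surj : {A : Set} {k : ℕ} → (A → Fin k) → Set
Surj {A} {k} c = (i : Fin k) → Σ A (λ v → c v ≡ i)

Monochromatic : (G : Graph) {k : ℕ} → (V G → Fin k) → VSet G → Set
Monochromatic G {k} c S = Σ (Fin k) (λ i → (v : V G) → S v → c v ≡ i)

IsMVD : (G : Graph) {k : ℕ} → (V G → Fin k) → Set₁
IsMVD G c = (x y : V G) → x ≢ y → ¬ Adj G x y →
  Σ (VSet G) (λ S → IsCut G S x y × Monochromatic G c S)

HasMVD : Graph → ℕ → Set₁
HasMVD G k = Σ (V G → Fin k) (λ c → Surj c × IsMVD G c)

MvdIsOne : Graph → Set₁
MvdIsOne G = HasMVD G 1 × ((k : ℕ) → HasMVD G k → k ≤ 1)

CycleAdj : (m : ℕ) → Fin m → Fin m → Set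
CycleAdj m i j =
  (toℕ j ≡ suc (toℕ i)) ⊎ (toℕ i ≡ suc (toℕ j)) ⊎
  (toℕ i ≡ 0 × suc (toℕ j) ≡ m) ⊎ (toℕ j ≡ 0 × suc (toℕ i) ≡ m)

-- wheel W_{m+1} = C_m ∨ K_1 ; the hub is vertex zero
WheelAdj : (m : ℕ) → Fin (suc m) → Fin (suc m) → Set
WheelAdj m Fin.zero    Fin.zero    = ⊥
WheelAdj m Fin.zero    (Fin.suc j) = ⊤
WheelAdj m (Fin.suc i) Fin.zero    = ⊤
WheelAdj m (Fin.suc i) (Fin.suc j) = CycleAdj m i j

Wheel : ℕ → Graph
Wheel m = record { V = Fin (suc m) ; Adj = WheelAdj m }

CompleteMultipartite : (k : ℕ) → (Fin k → ℕ) → Graph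
CompleteMultipartite k sz = record
  { V   = Σ (Fin k) (λ i → Fin (sz i))
  ; Adj = λ u v → Σ.proj₁ u ≢ Σ.proj₁ v }

-- An MVD-colouring must give every common neighbour of two non-adjacent vertices the colour of
-- their monochromatic cut, since a common neighbour outside the cut would join them.  In W_n
-- (n ≥ 5) each rim vertex and the hub are common neighbours of the two rim vertices flanking it,
-- which are non-adjacent because the rim has at least four vertices; so every rim vertex gets the
-- colour of the hub.  In K_{n_1,…,n_k} two vertices of a part of size ≥ 2 are non-adjacent with
-- all vertices outside that part as common neighbours, so everything outside that part has one
-- colour; with two such parts and a third part this colour is shared by all vertices.
module Submission where

open import Defs
open import Data.Nat using (ℕ; zero; suc; _+_; _≤_; _<_; z≤n; s≤s; _<?_)
open import Data.Nat.Properties using (≤-refl; ≤-antisym; ≤-pred; ≰⇒>; m+n≤o⇒n≤o; m≤n⇒m≤1+n)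
open import Data.Fin using (Fin; toℕ; fromℕ; fromℕ<; inject₁) renaming (zero to fzero; suc to fsuc)
open import Data.Fin.Properties using (_≟_; toℕ-fromℕ<; toℕ<n; suc-injective; fromℕ≢inject₁)
open import Data.Product using (Σ; _×_; _,_; proj₁)
open import Data.Sum using (_⊎_; inj₁; inj₂)
open import Data.Empty using (⊥-elim)
open import Data.Unit using (tt)
open import Function using (_∘_)
open import Relation.Nullary using (¬_; yes; no)
open import Relation.Nullary.Decidable using (decidable-stable)
open import Relation.Binary.PropositionalEquality
  using (_≡_; _≢_; refl; sym; trans; cong; subst₂; ≢-sym)

Irreflexive : Graph → Set
Irreflexive G = (x : V G) → ¬ Adj G x x

module _ {G : Graph} where

  reach-avoidingNeighbours⇒≡ : {x y : V G} → Reach G (Adj G x) x y → x ≡ y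
  reach-avoidingNeighbours⇒≡ here = refl
  reach-avoidingNeighbours⇒≡ (step r a ¬xz) with reach-avoidingNeighbours⇒≡ r
  ... | refl = ⊥-elim (¬xz a)

  neighbourhood-isCut : Irreflexive G → {x y : V G} → x ≢ y → ¬ Adj G x y → IsCut G (Adj G x) x y
  neighbourhood-isCut irr {x} x≢y ¬xy = irr x , ¬xy , λ r → x≢y (reach-avoidingNeighbours⇒≡ r)

  constant-isMVD : Irreflexive G → {k : ℕ} (i : Fin k) → IsMVD G (λ _ → i)
  constant-isMVD irr i x y x≢y ¬xy = Adj G x , neighbourhood-isCut irr x≢y ¬xy , i , λ _ _ → refl

  commonNeighbour-inCut : {S : VSet G} {x y w : V G} → IsCut G S x y →
                          Adj G x w → Adj G w y → ¬ ¬ S w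
  commonNeighbour-inCut (_ , ¬Sy , ¬reach) xw wy ¬Sw = ¬reach (step (step here xw ¬Sw) wy ¬Sy)

  commonNeighbour-colour : {k : ℕ} {c : V G → Fin k} {S : VSet G} {i : Fin k} {x y w : V G} →
                           IsCut G S x y → ((v : V G) → S v → c v ≡ i) →
                           Adj G x w → Adj G w y → c w ≡ i
  commonNeighbour-colour {c = c} {i = i} {w = w} cut mono xw wy =
    decidable-stable (c w ≟ i) (λ cw≢i → commonNeighbour-inCut cut xw wy (λ Sw → cw≢i (mono w Sw)))

  commonNeighbours-sameColour : {k : ℕ} {c : V G → Fin k} → IsMVD G c →
                                {x y w w′ : V G} → x ≢ y → ¬ Adj G x y →
                                Adj G x w → Adj G w y → Adj G x w′ → Adj G w′ y → c w ≡ c w′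
  commonNeighbours-sameColour mvd {x} {y} x≢y ¬xy xw wy xw′ w′y
    with mvd x y x≢y ¬xy
  ... | _ , cut , _ , mono =
    trans (commonNeighbour-colour cut mono xw wy) (sym (commonNeighbour-colour cut mono xw′ w′y))

surjective∧constant⇒≤1 : {A : Set} {k : ℕ} {c : A → Fin k} → Surj c →
                         (a₀ : A) → ((a : A) → c a ≡ c a₀) → k ≤ 1
surjective∧constant⇒≤1 {k = zero}        _    _  _     = z≤n
surjective∧constant⇒≤1 {k = suc zero}    _    _  _     = s≤s z≤n
surjective∧constant⇒≤1 {k = suc (suc k)} surj a₀ const
  with surj fzero | surj (fsuc fzero)
... | a , ca≡0 | b , cb≡1
  with trans (sym ca≡0) (trans (const a) (trans (sym (const b)) cb≡1))
... | ()

mvdIsOne : {G : Graph} → Irreflexive G → (v₀ : V G) →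
           ({k : ℕ} (c : V G → Fin k) → IsMVD G c → (v : V G) → c v ≡ c v₀) → MvdIsOne G
mvdIsOne irr v₀ constant =
  ((λ _ → fzero) , (λ { fzero → v₀ , refl }) , constant-isMVD irr fzero) ,
  λ k (c , surj , mvd) → surjective∧constant⇒≤1 surj v₀ (constant c mvd)

-- `CycleAdj m a b` is definitionally `CycleAdjℕ m (toℕ a) (toℕ b)`.
CycleAdjℕ : ℕ → ℕ → ℕ → Set
CycleAdjℕ m p q =
  (q ≡ suc p) ⊎ (p ≡ suc q) ⊎ (p ≡ 0 × suc q ≡ m) ⊎ (q ≡ 0 × suc p ≡ m)

cycleAdjℕ-irrefl : {m p : ℕ} → 2 ≤ m → ¬ CycleAdjℕ m p p
cycleAdjℕ-irrefl _ (inj₁ ())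
cycleAdjℕ-irrefl _ (inj₂ (inj₁ ()))
cycleAdjℕ-irrefl (s≤s ()) (inj₂ (inj₂ (inj₁ (refl , refl))))
cycleAdjℕ-irrefl (s≤s ()) (inj₂ (inj₂ (inj₂ (refl , refl))))

wheel-irreflexive : {m : ℕ} → 2 ≤ m → Irreflexive (Wheel m)
wheel-irreflexive _   fzero    ()
wheel-irreflexive 2≤m (fsuc i) = cycleAdjℕ-irrefl 2≤m

record NonadjacentNeighbours (m r : ℕ) : Set where
  field
    p q     : ℕ
    p<m     : p < m
    q<m     : q < m
    p≢q     : p ≢ q
    ¬adj    : ¬ CycleAdjℕ m p q
    p-adj-r : CycleAdjℕ m p r
    r-adj-q : CycleAdjℕ m r q

nonadjacentNeighbours : (n r : ℕ) → r < 4 + n → NonadjacentNeighbours (4 + n) r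
nonadjacentNeighbours n zero _ = record
  { p = 3 + n ; q = 1 ; p<m = ≤-refl ; q<m = s≤s (s≤s z≤n) ; p≢q = λ ()
  ; ¬adj = λ { (inj₁ ()) ; (inj₂ (inj₁ ())) ; (inj₂ (inj₂ (inj₁ (() , _)))) ; (inj₂ (inj₂ (inj₂ (() , _)))) }
  ; p-adj-r = inj₂ (inj₂ (inj₂ (refl , refl))) ; r-adj-q = inj₁ refl }
nonadjacentNeighbours n (suc t) r<m with 2 + t <? 4 + n
... | yes t+2<m = record
  { p = t ; q = 2 + t ; p<m = m+n≤o⇒n≤o 2 t+2<m ; q<m = t+2<m ; p≢q = λ ()
  ; ¬adj = λ { (inj₁ ()) ; (inj₂ (inj₁ ())) ; (inj₂ (inj₂ (inj₁ (refl , ())))) ; (inj₂ (inj₂ (inj₂ (() , _)))) }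
  ; p-adj-r = inj₁ refl ; r-adj-q = inj₁ refl }
-- Otherwise r is the last position m − 1, flanked by m − 2 and 0.
... | no t+2≮m with ≤-antisym (≤-pred (≤-pred r<m)) (≤-pred (≤-pred (≤-pred (≰⇒> t+2≮m))))
...   | refl = record
  { p = 2 + n ; q = 0 ; p<m = m≤n⇒m≤1+n ≤-refl ; q<m = s≤s z≤n ; p≢q = λ ()
  ; ¬adj = λ { (inj₁ ()) ; (inj₂ (inj₁ ())) ; (inj₂ (inj₂ (inj₁ (() , _)))) ; (inj₂ (inj₂ (inj₂ (refl , ())))) }
  ; p-adj-r = inj₁ refl ; r-adj-q = inj₂ (inj₂ (inj₂ (refl , refl))) }

rim-colour≡hub-colour : (n : ℕ) {k : ℕ} {c : Fin (5 + n) → Fin k} → IsMVD (Wheel (4 + n)) c →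
                        (v : Fin (4 + n)) → c (fsuc v) ≡ c fzero
rim-colour≡hub-colour n mvd v =
  commonNeighbours-sameColour mvd a≢b
    (¬adj ∘ subst₂ (CycleAdjℕ (4 + n)) a≡p b≡q)
    (subst₂ (CycleAdjℕ (4 + n)) (sym a≡p) refl p-adj-r)
    (subst₂ (CycleAdjℕ (4 + n)) refl (sym b≡q) r-adj-q)
    tt tt
  where
  open NonadjacentNeighbours (nonadjacentNeighbours n (toℕ v) (toℕ<n v))
  a≡p = toℕ-fromℕ< p<m
  b≡q = toℕ-fromℕ< q<m
  a≢b : fsuc (fromℕ< p<m) ≢ fsuc (fromℕ< q<m)
  a≢b e = p≢q (trans (sym a≡p) (trans (cong toℕ (suc-injective e)) b≡q))

wheel-mvdIsOne : (m : ℕ) → 4 ≤ m → MvdIsOne (Wheel m)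
wheel-mvdIsOne (suc (suc (suc (suc n)))) (s≤s (s≤s (s≤s (s≤s _)))) =
  mvdIsOne (wheel-irreflexive (s≤s (s≤s z≤n))) fzero
    (λ c mvd → λ { fzero → refl ; (fsuc v) → rim-colour≡hub-colour n mvd v })

distinctPair : {s : ℕ} → 2 ≤ s → Σ (Fin s) λ a → Σ (Fin s) λ b → a ≢ b
distinctPair (s≤s (s≤s _)) = fzero , fsuc fzero , λ ()

module _ {K : ℕ} {sz : Fin K → ℕ} where

  private
    G : Graph
    G = CompleteMultipartite K sz

  outsidePart-sameColour : {k : ℕ} {c : V G → Fin k} → IsMVD G c →
                           {P : Fin K} → 2 ≤ sz P → {w w′ : V G} →
                           proj₁ w ≢ P → proj₁ w′ ≢ P → c w ≡ c w′
  outsidePart-sameColour mvd {P} 2≤szP w∉P w′∉P with distinctPair 2≤szP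
  ... | a , b , a≢b =
    commonNeighbours-sameColour mvd {P , a} {P , b} (λ { refl → a≢b refl }) (λ P≢P → P≢P refl)
      (≢-sym w∉P) w∉P (≢-sym w′∉P) w′∉P

  completeMultipartite-mvdIsOne : (A B : Fin K) → A ≢ B → 2 ≤ sz A → 2 ≤ sz B →
                                  (v₀ : V G) → proj₁ v₀ ≢ A → proj₁ v₀ ≢ B → MvdIsOne G
  completeMultipartite-mvdIsOne A B A≢B 2≤szA 2≤szB v₀ v₀∉A v₀∉B =
    mvdIsOne (λ _ P≢P → P≢P refl) v₀ constant
    where
    constant : {k : ℕ} (c : V G → Fin k) → IsMVD G c → (v : V G) → c v ≡ c v₀
    constant c mvd v with proj₁ v ≟ A
    ... | yes refl = outsidePart-sameColour mvd 2≤szB A≢B v₀∉B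
    ... | no v∉A   = outsidePart-sameColour mvd 2≤szA v∉A v₀∉A

theorem3p1 : ((m : ℕ) → 4 ≤ m → MvdIsOne (Wheel m))
    ×
    ((k' : ℕ) → (sz : Fin (suc (suc (suc k'))) → ℕ) →
    ((i : Fin (suc (suc (suc k')))) → 1 ≤ sz i) →
    2 ≤ sz (fromℕ (suc (suc k'))) →
    2 ≤ sz (inject₁ (fromℕ (suc k'))) →
    MvdIsOne (CompleteMultipartite (suc (suc (suc k'))) sz))
theorem3p1 = wheel-mvdIsOne , λ k' sz nonempty 2≤szA 2≤szB →
  completeMultipartite-mvdIsOne (fromℕ (2 + k')) (inject₁ (fromℕ (1 + k'))) fromℕ≢inject₁ 2≤szA 2≤szB
    (fzero , fromℕ< (nonempty fzero)) (λ ()) (λ ())
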